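{- Let $M$ be an $S$-sorted $<\kappa$-ary pure clone. Let $d=(\pi_{(S\times S,p_2,(s,s))})_{s\in S}\in\mathrm{H}_S(M)$, and for each $s\in S$ let $e_s=(e_{s,t}\circ\pi_{(S,\mathrm{id}_S,s)})_{t\in S}\in\mathrm{H}_1(M)$, where $e_{s,t}\in M_{s\to t}$ and $e_{s,s}=\pi_{(\{s\},\mathrm{id},s)}$ (the identity of sort $s\to s$). Then $(d,(e_s)_{s\in S})$ is an $S$-ary diagonal pair of $\mathrm{H}(M)$, and $(\mathrm{H}(M))_d$ is isomorphic to $M$ via the isomorphism $\mu_{(\lambda,v,s)}:M_{(\lambda,v,s)}\to(\mathrm{H}(M))_{d,(\lambda,v,s)}$, $f\mapsto\big(e_{s,t}\circ f\circ(\pi_{(\lambda\times S,p_2,(i,v(i)))})_{i\in\lambda}\big)_{t\in S}/\sim$, where $(f_t)_t\sim(g_t)_t$ iff $f_t\circ(e_{v(i),u}\circ\pi_{(\lambda\times S,p_2,(i,v(i)))})_{(i,u)\in\lambda\times S}=g_t\circ(e_{v(i),u}\circ\pi_{(\lambda\times S,p_2,(i,v(i)))})_{(i,u)\in\lambda\times S}$ for all $t\in S$.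
   Context: $S$ is a nonzero cardinal (set of smaller ordinals), $\kappa>S$ infinite. An $S$-sorted $<\kappa$-ary clone $M$ consists of sets $M_{(\lambda,v,s)}$ ($\lambda<\kappa$, $v:\lambda\to S$, $s\in S$; sets of size $<\kappa$ may serve as arities), projections $\pi_{(\lambda,v,i)}\in M_{(\lambda,v,v(i))}$ and associative compositions $(f,(g_i)_{i\in\lambda_1})\mapsto f\circ(g_i)_i$, $M_{(\lambda_1,v_1,s)}\times\prod_iM_{(\lambda_2,v_2,v_1(i))}\to M_{(\lambda_2,v_2,s)}$, with projections as units; $M_{s\to t}$ is the sort $(1,v,t)$ with $v(0)=s$. $M$ is pure if all $M_{s_1\to s_2}$ are nonempty. Clone isomorphisms are sortwise bijections preserving projections and composition. $\mathrm{H}(M)$ is the single-sorted clone with $\mathrm{H}_\lambda(M)=\prod_{s}M_{(\lambda\times S,p_2,s)}$ ($p_2$ the second projection; $\mathrm{H}_1(M)$ identified with $\prod_sM_{(S,\mathrm{id}_S,s)}$), projections $\pi_{(\lambda,i)}=(\pi_{(\lambda\times S,p_2,(i,s))})_s$, composition $(f_s)_s\circ((g_{i,t})_t)_i=(f_s\circ(g_{i,t})_{(i,t)})_s$. For a single-sorted clone $C$, an $S$-ary diagonal pair is $(d,(e_s)_s)$, $d\in C_S$, $e_s\in C_1$, with (1) $e_s\circ d=e_s\circ\pi_{(S,s)}$; (2) $d\circ(e_s\circ\pi_{(S,s)})_{s\in S}=d$; (3) $d\circ(\pi_{(S,0)})_{s\in S}=\pi_{(S,0)}$; the heterogenization $C_d$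 is the $S$-sorted clone with $C_{d,(\lambda,v,t)}=\{f\in C_\lambda:e_t\circ f=f\}/\sim$, $f\sim g$ iff $f\circ(e_{v(i)}\circ\pi_{(\lambda,i)})_i=g\circ(e_{v(i)}\circ\pi_{(\lambda,i)})_i$, projections $e_{v(i)}\circ\pi_{(\lambda,i)}/\sim$, composition induced from $C$. -}

module Defs where

open import Data.Unit using (⊤; tt)
open import Data.Product using (Σ; _×_; _,_; proj₁; proj₂)
open import Relation.Binary.PropositionalEquality using (_≡_)
open import Function using (const)

-- The class of admissible arities ("sets of size < κ"), for a sort set S.
-- For κ > S infinite, the sets of size < κ contain the one-point set and S
-- and are closed under A ↦ A × S; these are the only closure facts used.
record Arities (S : Set) : Set₁ where
  field
    Small    : Set → Set
    small-⊤  : Small ⊤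
    small-S  : Small S
    small-×S : ∀ {A} → Small A → Small (A × S)

-- An S-sorted <κ-ary clone.  Sort (λ , v , s) is  M λ a v s  (a : λ is small).
record SortedClone (S : Set) (Ar : Arities S) : Set₁ where
  open Arities Ar
  field
    M     : (A : Set) → Small A → (A → S) → S → Set
    π     : ∀ {A} {a : Small A} (v : A → S) (i : A) → M A a v (v i)
    comp  : ∀ {A} {a : Small A} {B} {b : Small B} {v : A → S} {w : B → S} {s : S}
            → M A a v s → ((i : A) → M B b w (v i)) → M B b w s
    comp-assoc : ∀ {A} {a : Small A} {B} {b : Small B} {C} {c : Small C}
                   {u : A → S} {v : B → S} {w : C → S} {s : S}
                   (f : M A a u s) (g : (i : A) → M B b v (u i))
                   (h : (j : B) → M C c w (v j))
                 → comp (comp f g) h ≡ comp f (λ i → comp (g i) h)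
    comp-π-left : ∀ {A} {a : Small A} {B} {b : Small B} {v : A → S} {w : B → S}
                    (i : A) (g : (j : A) → M B b w (v j))
                  → comp (π {a = a} v i) g ≡ g i
    comp-π-right : ∀ {A} {a : Small A} {v : A → S} {s : S} (f : M A a v s)
                   → comp f (π {a = a} v) ≡ f
    -- families are set-theoretic functions: composition depends only on values
    comp-cong : ∀ {A} {a : Small A} {B} {b : Small B} {v : A → S} {w : B → S} {s : S}
                  (f : M A a v s) (g g′ : (i : A) → M B b w (v i))
                → (∀ i → g i ≡ g′ i) → comp f g ≡ comp f g′

module _ {S : Set} {Ar : Arities S} (𝓜 : SortedClone S Ar) where
  open Arities Ar

  Hom : S → S → Set
  Hom s t = SortedClone.M 𝓜 ⊤ small-⊤ (const s) t

  Pure : Set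
  Pure = ∀ s t → Hom s t

record RawClone₁ {S : Set} (Ar : Arities S) : Set₁ where
  open Arities Ar
  field
    C    : (A : Set) → Small A → Set
    _≈_  : ∀ {A} {a : Small A} → C A a → C A a → Set
    π    : ∀ {A} {a : Small A} → A → C A a
    comp : ∀ {A} {a : Small A} {B} {b : Small B} → C A a → (A → C B b) → C B b

H : ∀ {S : Set} {Ar : Arities S} → SortedClone S Ar → RawClone₁ Ar
H {S} {Ar} M = record
  { C    = λ A a → (s : S) → SortedClone.M M (A × S) (small-×S a) proj₂ s
  ; _≈_  = λ f g → ∀ s → f s ≡ g s
  ; π    = λ i s → SortedClone.π M proj₂ (i , s)
  ; comp = λ f g s → SortedClone.comp M (f s) (λ p → g (proj₁ p) (proj₂ p))
  }
  where open Arities Ar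

-- S-ary diagonal pair (d , (e_s)_s) of a single-sorted clone; s₀ is the ordinal 0 ∈ S.
record DiagonalPair {S : Set} {Ar : Arities S} (C : RawClone₁ Ar) (s₀ : S)
         (d : RawClone₁.C C S (Arities.small-S Ar))
         (e : S → RawClone₁.C C ⊤ (Arities.small-⊤ Ar)) : Set where
  open Arities Ar
  open RawClone₁ C
  field
    diag-1 : ∀ s → comp (e s) (λ _ → d) ≈ comp (e s) (λ _ → π {a = small-S} s)
    diag-2 : comp d (λ s → comp (e s) (λ _ → π {a = small-S} s)) ≈ d
    diag-3 : comp d (λ _ → π {a = small-S} s₀) ≈ π {a = small-S} s₀

-- The heterogenization C_d (it depends on the pair only through e).
module Heterogenization {S : Set} {Ar : Arities S} (𝓒 : RawClone₁ Ar)
         (e : S → RawClone₁.C 𝓒 ⊤ (Arities.small-⊤ Ar)) where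
  open Arities Ar
  open RawClone₁ 𝓒

  -- membership in the underlying set of sort (λ , v , t):  e_t ∘ f = f
  InSort : ∀ {A} {a : Small A} → S → C A a → Set
  InSort t f = comp (e t) (λ _ → f) ≈ f

  _∼⟨_⟩_ : ∀ {A} {a : Small A} → C A a → (A → S) → C A a → Set
  _∼⟨_⟩_ {a = a} f v g = comp f (λ i → comp (e (v i)) (λ _ → π {a = a} i)) ≈ comp g (λ i → comp (e (v i)) (λ _ → π {a = a} i))

  hproj : ∀ {A} {a : Small A} → (A → S) → A → C A a
  hproj {a = a} v i = comp (e (v i)) (λ _ → π {a = a} i)

  hcomp : ∀ {A} {a : Small A} {B} {b : Small B} → C A a → (A → C B b) → C B b
  hcomp = comp

record IsIsoToHetero {S : Set} {Ar : Arities S} (𝓜 : SortedClone S Ar) (𝓒 : RawClone₁ Ar)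
         (e : S → RawClone₁.C 𝓒 ⊤ (Arities.small-⊤ Ar))
         (μ : ∀ {A} {a : Arities.Small Ar A} {v : A → S} {s : S}
              → SortedClone.M 𝓜 A a v s → RawClone₁.C 𝓒 A a) : Set₁ where
  open Arities Ar
  open Heterogenization 𝓒 e
  module M = SortedClone 𝓜
  module C = RawClone₁ 𝓒
  field
    μ-sort : ∀ {A} {a : Small A} {v : A → S} {s : S} (f : M.M A a v s) → InSort s (μ f)
    μ-inj  : ∀ {A} {a : Small A} {v : A → S} {s : S} (f g : M.M A a v s)
             → μ f ∼⟨ v ⟩ μ g → f ≡ g
    μ-surj : ∀ {A} {a : Small A} {v : A → S} {s : S} (h : C.C A a)
             → InSort s h → Σ (M.M A a v s) (λ f → μ f ∼⟨ v ⟩ h)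
    μ-proj : ∀ {A} {a : Small A} (v : A → S) (i : A)
             → μ (M.π {a = a} v i) ∼⟨ v ⟩ hproj v i
    μ-comp : ∀ {A} {a : Small A} {B} {b : Small B} {v : A → S} {w : B → S} {s : S}
               (f : M.M A a v s) (g : (i : A) → M.M B b w (v i))
             → μ (M.comp f g) ∼⟨ w ⟩ hcomp (μ f) (λ i → μ (g i))

module _ {S : Set} {Ar : Arities S} (𝓜 : SortedClone S Ar) where
  open Arities Ar
  open SortedClone 𝓜 using (π; comp)

  dH : RawClone₁.C (H 𝓜) S small-S
  dH s = π proj₂ (s , s)

  -- e_s = (e_{s,t} ∘ π_(1×S, p₂, (0,s)))_t ∈ H_1(M)   (H_1 with 1 × S ≅ S)
  eH : ((s t : S) → Hom 𝓜 s t) → S → RawClone₁.C (H 𝓜) ⊤ small-⊤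
  eH ε s t = comp (ε s t) (λ _ → π proj₂ (tt , s))

  μH : ((s t : S) → Hom 𝓜 s t) → ∀ {A} {a : Small A} {v : A → S} {s : S}
       → SortedClone.M 𝓜 A a v s → RawClone₁.C (H 𝓜) A a
  μH ε {v = v} {s = s} f t = comp (ε s t) (λ _ → comp f (λ i → π proj₂ (i , v i)))

module Submission where

open import Defs
open import Data.Unit using (⊤; tt)
open import Data.Product using (Σ; _×_; _,_; proj₁; proj₂)
open import Relation.Binary.PropositionalEquality using (_≡_; sym; trans; cong; module ≡-Reasoning)
open import Function using (const)

-- Precomposing with the diagonal projections (π_(i, v i))_i embeds
-- M_(λ,v,s) into M_(λ×S,p₂,s), with retraction x ↦ x ∘ (e_{v i,u} ∘ π_i)_(i,u)
-- because e_{s,s} is the identity.  An element h of sort s of H(M)_d is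
-- determined by its s-th component, the others being h_t = e_{s,t} ∘ h_s, and
-- h ∼ h′ says exactly that these components agree after precomposition with
-- (e_{v i,u} ∘ π_(i, v i))_(i,u), which factors through the retraction.  So μ
-- is, up to ∼, the embedding followed by this bookkeeping, hence bijective,
-- and it commutes with projections and composition on the nose.

module Homogenization {S : Set} {Ar : Arities S} (𝓜 : SortedClone S Ar)
  (ε : (s t : S) → Hom 𝓜 s t)
  (ε-refl : ∀ s → ε s s ≡ SortedClone.π 𝓜 {a = Arities.small-⊤ Ar} (const s) tt) where
  open Arities Ar
  open SortedClone 𝓜
  open Heterogenization (H 𝓜) (eH 𝓜 ε)
  open ≡-Reasoning

  HM : (A : Set) → Small A → Set
  HM = RawClone₁.C (H 𝓜)

  comp-ε-refl : ∀ {B} {b : Small B} {w : B → S} s (x : M B b w s) → comp (ε s s) (const x) ≡ x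
  comp-ε-refl s x = trans (cong (λ e → comp e (const x)) (ε-refl s)) (comp-π-left tt (const x))

  comp-eH : ∀ {B} {b : Small B} {w : B → S} s t (g : (p : ⊤ × S) → M B b w (proj₂ p))
            → comp (eH 𝓜 ε s t) g ≡ comp (ε s t) (const (g (tt , s)))
  comp-eH s t g = trans (comp-assoc (ε s t) _ g) (comp-cong (ε s t) _ _ (λ _ → comp-π-left (tt , s) g))

  diagonalPair : (s₀ : S) → DiagonalPair (H 𝓜) s₀ (dH 𝓜) (eH 𝓜 ε)
  diagonalPair s₀ = record
    { diag-1 = λ s t → trans (comp-eH s t _) (sym (comp-eH s t _))
    ; diag-2 = λ t → trans (comp-π-left (t , t) _) (trans (comp-eH t t _) (comp-ε-refl t _))
    ; diag-3 = λ t → comp-π-left (t , t) _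
    }

  module _ {A} {a : Small A} (v : A → S) where

    diagProj : (i : A) → M (A × S) (small-×S a) proj₂ (v i)
    diagProj i = π proj₂ (i , v i)

    spread : (p : A × S) → M (A × S) (small-×S a) proj₂ (proj₂ p)
    spread (i , u) = comp (ε (v i) u) (const (diagProj i))

    collapse : (p : A × S) → M A a v (proj₂ p)
    collapse (i , u) = comp (ε (v i) u) (const (π v i))

    diagProj-∘-spread : ∀ i → comp (diagProj i) spread ≡ diagProj i
    diagProj-∘-spread i = trans (comp-π-left (i , v i) spread) (comp-ε-refl (v i) _)

    diagProj-∘-collapse : ∀ i → comp (diagProj i) collapse ≡ π v i
    diagProj-∘-collapse i = trans (comp-π-left (i , v i) collapse) (comp-ε-refl (v i) _)

    collapse-∘-diagProj : ∀ p → comp (collapse p) diagProj ≡ spread p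
    collapse-∘-diagProj (i , u) =
      trans (comp-assoc (ε (v i) u) _ _) (comp-cong (ε (v i) u) _ _ (λ _ → comp-π-left i diagProj))

    hproj-≡-spread : ∀ p → hproj v (proj₁ p) (proj₂ p) ≡ spread p
    hproj-≡-spread (i , u) = comp-eH (v i) u _

    ∼⇒∘spread-≡ : ∀ {x y : HM A a} → x ∼⟨ v ⟩ y → ∀ t → comp (x t) spread ≡ comp (y t) spread
    ∼⇒∘spread-≡ {x} {y} x∼y t =
      trans (comp-cong (x t) _ _ (λ p → sym (hproj-≡-spread p)))
            (trans (x∼y t) (comp-cong (y t) _ _ hproj-≡-spread))

    ∘spread-≡⇒∼ : ∀ {x y : HM A a} → (∀ t → comp (x t) spread ≡ comp (y t) spread) → x ∼⟨ v ⟩ y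
    ∘spread-≡⇒∼ {x} {y} eq t =
      trans (comp-cong (x t) _ _ hproj-≡-spread)
            (trans (eq t) (comp-cong (y t) _ _ (λ p → sym (hproj-≡-spread p))))

    pointwise⇒∼ : ∀ {x y : HM A a} → (∀ t → x t ≡ y t) → x ∼⟨ v ⟩ y
    pointwise⇒∼ eq t = cong (λ z → comp z (λ p → hproj v (proj₁ p) (proj₂ p))) (eq t)

    inflate : ∀ {s} → M A a v s → M (A × S) (small-×S a) proj₂ s
    inflate f = comp f diagProj

    inflate-∘-spread : ∀ {s} (f : M A a v s) → comp (inflate f) spread ≡ inflate f
    inflate-∘-spread f = trans (comp-assoc f diagProj spread) (comp-cong f _ _ diagProj-∘-spread)

    inflate-∘-collapse : ∀ {s} (f : M A a v s) → comp (inflate f) collapse ≡ f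
    inflate-∘-collapse f =
      trans (comp-assoc f diagProj collapse) (trans (comp-cong f _ _ diagProj-∘-collapse) (comp-π-right f))

    inflate-comp-collapse : ∀ {s} (x : M (A × S) (small-×S a) proj₂ s) → inflate (comp x collapse) ≡ comp x spread
    inflate-comp-collapse x = trans (comp-assoc x collapse diagProj) (comp-cong x _ _ collapse-∘-diagProj)

  μ : ∀ {A} {a : Small A} {v : A → S} {s : S} → M A a v s → HM A a
  μ = μH 𝓜 ε

  module _ {A} {a : Small A} {v : A → S} {s : S} where

    μ-at-own-sort : (f : M A a v s) → μ f s ≡ inflate v f
    μ-at-own-sort f = comp-ε-refl s (inflate v f)

    μ-∘-spread : (f : M A a v s) (t : S) → comp (μ f t) (spread v) ≡ μ f t
    μ-∘-spread f t = trans (comp-assoc (ε s t) _ _) (comp-cong (ε s t) _ _ (λ _ → inflate-∘-spread v f))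

    inSort-components : ∀ {h : HM A a} → InSort s h → ∀ t → h t ≡ comp (ε s t) (const (h s))
    inSort-components h∈s t = trans (sym (h∈s t)) (comp-eH s t _)

    μ-inSort : (f : M A a v s) → InSort s (μ f)
    μ-inSort f t = trans (comp-eH s t _) (comp-cong (ε s t) _ _ (λ _ → μ-at-own-sort f))

    μ-injective : (f g : M A a v s) → μ f ∼⟨ v ⟩ μ g → f ≡ g
    μ-injective f g f∼g = begin
      f                                ≡⟨ sym (inflate-∘-collapse v f) ⟩
      comp (inflate v f) (collapse v)  ≡⟨ cong (λ x → comp x (collapse v)) inflate-f≡inflate-g ⟩
      comp (inflate v g) (collapse v)  ≡⟨ inflate-∘-collapse v g ⟩
      g                                ∎
      where
      inflate-f≡inflate-g : inflate v f ≡ inflate v g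
      inflate-f≡inflate-g = begin
        inflate v f                ≡⟨ sym (μ-at-own-sort f) ⟩
        μ f s                      ≡⟨ sym (μ-∘-spread f s) ⟩
        comp (μ f s) (spread v)    ≡⟨ ∼⇒∘spread-≡ v f∼g s ⟩
        comp (μ g s) (spread v)    ≡⟨ μ-∘-spread g s ⟩
        μ g s                      ≡⟨ μ-at-own-sort g ⟩
        inflate v g                ∎

    μ-surjective : (h : HM A a) → InSort s h → Σ (M A a v s) (λ f → μ f ∼⟨ v ⟩ h)
    μ-surjective h h∈s = f , ∘spread-≡⇒∼ v λ t → begin
      comp (μ f t) (spread v)                            ≡⟨ μ-∘-spread f t ⟩
      comp (ε s t) (const (inflate v f))                 ≡⟨ cong (λ x → comp (ε s t) (const x)) (inflate-comp-collapse v (h s)) ⟩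
      comp (ε s t) (const (comp (h s) (spread v)))       ≡⟨ sym (comp-assoc (ε s t) _ _) ⟩
      comp (comp (ε s t) (const (h s))) (spread v)       ≡⟨ cong (λ x → comp x (spread v)) (sym (inSort-components h∈s t)) ⟩
      comp (h t) (spread v)                              ∎
      where
      f : M A a v s
      f = comp (h s) (collapse v)

  μ-π : ∀ {A} {a : Small A} (v : A → S) (i : A) → μ (π {a = a} v i) ∼⟨ v ⟩ hproj v i
  μ-π v i = pointwise⇒∼ v λ t →
    trans (comp-cong (ε (v i) t) _ _ (λ _ → comp-π-left i (diagProj v)))
          (sym (hproj-≡-spread v (i , t)))

  inflate-comp : ∀ {A} {a : Small A} {B} {b : Small B} {v : A → S} {w : B → S} {s : S}
                   (f : M A a v s) (g : (i : A) → M B b w (v i))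
                 → inflate w (comp f g) ≡ comp (inflate v f) (λ p → μ (g (proj₁ p)) (proj₂ p))
  inflate-comp {v = v} {w} f g = begin
    comp (comp f g) (diagProj w)                     ≡⟨ comp-assoc f g (diagProj w) ⟩
    comp f (λ i → inflate w (g i))                   ≡⟨ comp-cong f _ _ (λ i → sym (μ-at-own-sort (g i))) ⟩
    comp f (λ i → μ (g i) (v i))                     ≡⟨ comp-cong f _ _ (λ i → sym (comp-π-left (i , v i) _)) ⟩
    comp f (λ i → comp (diagProj v i) G)             ≡⟨ sym (comp-assoc f (diagProj v) G) ⟩
    comp (inflate v f) G                             ∎
    where G = λ p → μ (g (proj₁ p)) (proj₂ p)

  μ-comp : ∀ {A} {a : Small A} {B} {b : Small B} {v : A → S} {w : B → S} {s : S}
             (f : M A a v s) (g : (i : A) → M B b w (v i))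
           → μ (comp f g) ∼⟨ w ⟩ hcomp (μ f) (λ i → μ (g i))
  μ-comp {w = w} {s} f g = pointwise⇒∼ w λ t →
    trans (comp-cong (ε s t) _ _ (λ _ → inflate-comp f g)) (sym (comp-assoc (ε s t) _ _))

  μ-isIso : IsIsoToHetero 𝓜 (H 𝓜) (eH 𝓜 ε) (μH 𝓜 ε)
  μ-isIso = record
    { μ-sort = μ-inSort
    ; μ-inj  = μ-injective
    ; μ-surj = μ-surjective
    ; μ-proj = μ-π
    ; μ-comp = μ-comp
    }

-- The Pure hypothesis is unused: ε already inhabits every M_{s→t}.
proposition6p3 : {S : Set} (s₀ : S) (Ar : Arities S) (M : SortedClone S Ar)
    → Pure M
    → (ε : (s t : S) → Hom M s t)
    → (∀ s → ε s s ≡ SortedClone.π M {a = Arities.small-⊤ Ar} (const s) tt)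
    → DiagonalPair (H M) s₀ (dH M) (eH M ε)
    × IsIsoToHetero M (H M) (eH M ε) (μH M ε)
proposition6p3 s₀ Ar M _ ε ε-refl = diagonalPair s₀ , μ-isIso
  where open Homogenization M ε ε-refl
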